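{- Let $n \geq 5$ be an odd integer. Then Player $B$ has a winning strategy in the game $Z(n,d)$ for every integer $d \geq n+3$.
   Context: For integers $n \geq 4$ and $d \geq 2$, $Z(n,d)$ is the following two-player game. Initially the board contains the numbers $1,2,\dots,n$. Players $A$ and $B$ alternately cross out (remove) one number from the board, with $A$ moving first, until exactly two numbers remain. If the sum of the two remaining numbers is divisible by $d$, $A$ wins; otherwise $B$ wins. A player has a winning strategy if that player can force a win regardless of the opponent's moves. -}

module Defs where

open import Data.Nat using (ℕ; suc; _+_; _*_; _<_)
open import Data.Nat.Divisibility using (_∣_)
open import Data.List using (List; length; removeAt; applyUpTo)
open import Data.Nat.ListAction using (sum)
open import Data.Fin using (Fin)
open import Data.Product using (∃)
open import Relation.Nullary using (¬_)
open import Relation.Binary.PropositionalEquality using (_≡_)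

Odd : ℕ → Set
Odd n = ∃ λ k → n ≡ 2 * k + 1

board : ℕ → List ℕ
board n = applyUpTo suc n

-- Game Z(n,d) played on a board (list of remaining numbers).
-- Players alternately remove one entry; the game stops when exactly two
-- numbers remain; A wins iff d divides their sum, otherwise B wins.
-- BWinsA d xs : B has a winning strategy from board xs with A to move.
-- BWinsB d xs : B has a winning strategy from board xs with B to move.
mutual
  data BWinsA (d : ℕ) (xs : List ℕ) : Set where
    endA  : length xs ≡ 2 → ¬ (d ∣ sum xs) → BWinsA d xs
    moveA : 2 < length xs → ((i : Fin (length xs)) → BWinsB d (removeAt xs i)) → BWinsA d xs

  data BWinsB (d : ℕ) (xs : List ℕ) : Set where
    endB  : length xs ≡ 2 → ¬ (d ∣ sum xs) → BWinsB d xs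
    moveB : 2 < length xs → (i : Fin (length xs)) → BWinsA d (removeAt xs i) → BWinsB d xs

BHasWinningStrategy : ℕ → ℕ → Set
BHasWinningStrategy n d = BWinsA d (board n)

-- Every number on the board lies strictly between 0 and d, so the last two sum to a
-- multiple of d only if they sum to exactly d. Count the complementary pairs
-- x + y = d still on the board: A's removals never create one, and each removal of B
-- can destroy one. On 1, ..., n with d ≥ n + 3 such a pair x < y has d − n ≤ x < d/2,
-- so there are at most (n − 3)/2 of them, which is exactly the number of moves B makes.
module Submission where

open import Defs
open import Data.Nat using (ℕ; zero; suc; pred; _+_; _*_; _∸_; _⊔_; _≤_; _<_; _≥_; _≟_; z≤n; s≤s)
open import Data.Nat.Properties
open import Data.Nat.Divisibility using (_∣_; divides)
open import Data.Nat.ListAction using (sum)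
open import Data.Nat.Tactic.RingSolver using (solve-∀)
open import Data.Fin using (Fin; zero; suc)
open import Data.List using (List; []; _∷_; length; removeAt)
open import Data.List.Properties using (length-removeAt; length-applyUpTo)
open import Data.List.Relation.Unary.All as All using (All; []; _∷_)
import Data.List.Relation.Unary.All.Properties as All
open import Data.List.Relation.Unary.AllPairs using (AllPairs; []; _∷_)
import Data.List.Relation.Unary.AllPairs.Properties as AllPairs
open import Data.List.Relation.Unary.Any using (Any; here; any?)
open import Data.List.Relation.Binary.Sublist.Propositional using (_⊆_; _∷ʳ_; _∷_; ⊆-refl; lookup)
open import Data.List.Relation.Binary.Sublist.Propositional.Properties using (All-resp-⊆)
open import Function using (_∘_)
open import Data.Product using (∃-syntax; _,_; _×_)
open import Relation.Nullary using (¬_; yes; no; contradiction)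
open import Relation.Binary.PropositionalEquality using (_≡_; refl; sym; trans; cong; subst)

removeAt-⊆ : {A : Set} (xs : List A) (i : Fin (length xs)) → removeAt xs i ⊆ xs
removeAt-⊆ (x ∷ xs) zero    = x ∷ʳ ⊆-refl
removeAt-⊆ (x ∷ xs) (suc i) = refl ∷ removeAt-⊆ xs i

length-removeAt-suc : {A : Set} {n : ℕ} (xs : List A) (i : Fin (length xs)) →
                      length xs ≡ suc n → length (removeAt xs i) ≡ n
length-removeAt-suc xs i len = trans (length-removeAt xs i) (cong pred len)

module _ (d : ℕ) where

  NonZeroResidue : ℕ → Set
  NonZeroResidue x = 0 < x × x < d

  sum-of-residues-∣⇒≡ : ∀ {a b} → NonZeroResidue a → NonZeroResidue b → d ∣ a + b → a + b ≡ d
  sum-of-residues-∣⇒≡ {a} (0<a , _) _ (divides zero a+b≡0) =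
    contradiction (≤-trans 0<a (≤-trans (m≤m+n a _) (≤-reflexive a+b≡0))) λ ()
  sum-of-residues-∣⇒≡ _ _ (divides 1 a+b≡d) = trans a+b≡d (+-identityʳ d)
  sum-of-residues-∣⇒≡ (_ , a<d) (_ , b<d) (divides (suc (suc q)) a+b≡qd) =
    contradiction a+b≡qd (<⇒≢ (≤-trans (+-mono-< a<d b<d) (+-monoʳ-≤ d (m≤m+n d (q * d)))))

  pairs : List ℕ → ℕ
  pairs []       = 0
  pairs (x ∷ xs) with any? (λ y → x + y ≟ d) xs
  ... | yes _ = suc (pairs xs)
  ... | no  _ = pairs xs

  pairs-unpaired : ∀ x xs → ¬ Any (λ y → x + y ≡ d) xs → pairs (x ∷ xs) ≡ pairs xs
  pairs-unpaired x xs unpaired with any? (λ y → x + y ≟ d) xs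
  ... | yes paired = contradiction paired unpaired
  ... | no  _      = refl

  pairs-removeAt-≤ : ∀ xs (i : Fin (length xs)) → pairs (removeAt xs i) ≤ pairs xs
  pairs-removeAt-≤ (x ∷ xs) zero with any? (λ y → x + y ≟ d) xs
  ... | yes _ = n≤1+n _
  ... | no  _ = ≤-refl
  pairs-removeAt-≤ (x ∷ xs) (suc i)
    with any? (λ y → x + y ≟ d) (removeAt xs i) | any? (λ y → x + y ≟ d) xs
  ... | yes _      | yes _        = s≤s (pairs-removeAt-≤ xs i)
  ... | yes paired | no  unpaired = contradiction (lookup (removeAt-⊆ xs i) paired) unpaired
  ... | no  _      | yes _        = m≤n⇒m≤1+n (pairs-removeAt-≤ xs i)
  ... | no  _      | no  _        = pairs-removeAt-≤ xs i

  pairs-removeAt-pred : ∀ x xs → ∃[ i ] pairs (removeAt (x ∷ xs) i) ≤ pred (pairs (x ∷ xs))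
  pairs-removeAt-pred x xs with any? (λ y → x + y ≟ d) xs
  pairs-removeAt-pred x xs       | yes _ = zero , ≤-refl
  pairs-removeAt-pred x []       | no  _ = zero , ≤-refl
  pairs-removeAt-pred x (y ∷ ys) | no unpaired with pairs-removeAt-pred y ys
  ... | i , lowered = suc i , subst (_≤ pred (pairs (y ∷ ys)))
          (sym (pairs-unpaired x (removeAt (y ∷ ys) i) (unpaired ∘ lookup (removeAt-⊆ (y ∷ ys) i))))
          lowered

  unpaired-∤-sum : ∀ ys → length ys ≡ 2 → pairs ys ≤ 0 → All NonZeroResidue ys → ¬ d ∣ sum ys
  unpaired-∤-sum (a ∷ b ∷ []) refl unpaired (ra ∷ rb ∷ []) d∣a+b with any? (λ y → a + y ≟ d) (b ∷ [])
  ... | no a+b≢d = a+b≢d (here (sum-of-residues-∣⇒≡ ra rb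
                    (subst (d ∣_) (cong (a +_) (+-identityʳ b)) d∣a+b)))
  unpaired-∤-sum (a ∷ b ∷ []) refl () _ _ | yes _

  -- With A to move at length 3 + 2k, B has k moves left.
  mutual
    bWinsA : ∀ k xs → length xs ≡ 3 + 2 * k → pairs xs ≤ k → All NonZeroResidue xs → BWinsA d xs
    bWinsA zero xs len bound residues = moveA (subst (2 <_) (sym len) ≤-refl) λ i →
      let len′ = length-removeAt-suc xs i len in
      endB len′ (unpaired-∤-sum (removeAt xs i) len′ (≤-trans (pairs-removeAt-≤ xs i) bound)
                                (All-resp-⊆ (removeAt-⊆ xs i) residues))
    bWinsA (suc k) xs len bound residues = moveA (subst (2 <_) (sym len) (s≤s (s≤s (s≤s z≤n)))) λ i →
      bWinsB k (removeAt xs i) (trans (length-removeAt-suc xs i len) (cong (2 +_) (*-suc 2 k)))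
               (≤-trans (pairs-removeAt-≤ xs i) bound) (All-resp-⊆ (removeAt-⊆ xs i) residues)

    bWinsB : ∀ k xs → length xs ≡ 4 + 2 * k → pairs xs ≤ suc k → All NonZeroResidue xs → BWinsB d xs
    bWinsB k (x ∷ xs) len bound residues with pairs-removeAt-pred x xs
    ... | i , lowered = moveB (subst (2 <_) (sym len) (s≤s (s≤s (s≤s z≤n)))) i
      (bWinsA k (removeAt (x ∷ xs) i) (length-removeAt-suc (x ∷ xs) i len)
              (≤-trans lowered (pred-mono-≤ bound)) (All-resp-⊆ (removeAt-⊆ (x ∷ xs) i) residues))

  pairs-increasing-≤ : ∀ {lo hi N a xs} →
    (∀ {x y} → x + y ≡ d → x < y → y ≤ N → lo ≤ x × x < hi) →
    AllPairs _<_ xs → All (a ≤_) xs → All (_≤ N) xs → pairs xs ≤ hi ∸ (a ⊔ lo)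
  pairs-increasing-≤ bounds [] [] [] = z≤n
  pairs-increasing-≤ {lo} {hi} {a = a} {x ∷ xs} bounds (x<xs ∷ increasing) (a≤x ∷ _) (_ ∷ xs≤N)
    with pairs-increasing-≤ bounds increasing x<xs xs≤N | any? (λ y → x + y ≟ d) xs
  ... | ih | no _ = ≤-trans ih (∸-monoʳ-≤ hi (⊔-monoˡ-≤ lo (m≤n⇒m≤1+n a≤x)))
  ... | ih | yes paired with All.lookupAny (All.zip (x<xs , xs≤N)) paired
  ... | (x<y , y≤N) , x+y≡d with bounds x+y≡d x<y y≤N
  ... | lo≤x , x<hi = begin
    suc (pairs xs)           ≤⟨ s≤s ih ⟩
    suc (hi ∸ (suc x ⊔ lo))  ≡⟨ cong (λ m → suc (hi ∸ m)) (m≥n⇒m⊔n≡m (m≤n⇒m≤1+n lo≤x)) ⟩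
    suc (hi ∸ suc x)         ≡⟨ sym (+-∸-assoc 1 x<hi) ⟩
    hi ∸ x                   ≤⟨ ∸-monoʳ-≤ hi (⊔-lub a≤x lo≤x) ⟩
    hi ∸ (a ⊔ lo)            ∎
    where open ≤-Reasoning

board-increasing : ∀ n → AllPairs _<_ (board n)
board-increasing n = AllPairs.applyUpTo⁺₁ suc n λ i<j _ → s≤s i<j

board-positive : ∀ n → All (1 ≤_) (board n)
board-positive n = All.applyUpTo⁺₂ suc n λ _ → s≤s z≤n

board-≤ : ∀ n → All (_≤ n) (board n)
board-≤ n = All.applyUpTo⁺₁ suc n λ i<n → i<n

-- A complementary pair x < y ≤ N has x ≥ d − N = 3 + t and 2x < d ≤ 2(m + 3 + t).
board-pairs-≤ : ∀ m t → pairs (3 + 2 * m + 3 + t) (board (3 + 2 * m)) ≤ m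
board-pairs-≤ m t = subst (pairs d (board N) ≤_) (m+n∸n≡m m (3 + t))
  (pairs-increasing-≤ d complement-bounds (board-increasing N) (board-positive N) (board-≤ N))
  where
  N = 3 + 2 * m
  d = N + 3 + t
  hi = m + (3 + t)

  double-hi : ∀ m t → (m + (3 + t)) + (m + (3 + t)) ≡ (3 + 2 * m + 3 + t) + t
  double-hi = solve-∀

  complement-bounds : ∀ {x y} → x + y ≡ d → x < y → y ≤ N → 3 + t ≤ x × x < hi
  complement-bounds {x} {y} x+y≡d x<y y≤N = lo≤x , x<hi
    where
    open ≤-Reasoning
    lo≤x : 3 + t ≤ x
    lo≤x = +-cancelʳ-≤ N (3 + t) x (begin
      (3 + t) + N  ≡⟨ +-comm (3 + t) N ⟩
      N + (3 + t)  ≡⟨ sym (+-assoc N 3 t) ⟩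
      d            ≡⟨ sym x+y≡d ⟩
      x + y        ≤⟨ +-monoʳ-≤ x y≤N ⟩
      x + N        ∎)
    x+x<hi+hi : x + x < hi + hi
    x+x<hi+hi = begin-strict
      x + x    <⟨ +-monoʳ-< x x<y ⟩
      x + y    ≡⟨ x+y≡d ⟩
      d        ≤⟨ m≤m+n d t ⟩
      d + t    ≡⟨ sym (double-hi m t) ⟩
      hi + hi  ∎
    x<hi : x < hi
    x<hi = ≰⇒> λ hi≤x → <⇒≱ x+x<hi+hi (+-mono-≤ hi≤x hi≤x)

board-residues : ∀ n d → n < d → All (NonZeroResidue d) (board n)
board-residues n d n<d = All.zipWith (λ (0<x , x≤n) → 0<x , ≤-<-trans x≤n n<d)
                                     (board-positive n , board-≤ n)

bWins-board : ∀ m t → BWinsA (3 + 2 * m + 3 + t) (board (3 + 2 * m))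
bWins-board m t = bWinsA d m (board N) (length-applyUpTo suc N) (board-pairs-≤ m t)
                         (board-residues N d (<-≤-trans (m<m+n N (s≤s z≤n)) (m≤m+n (N + 3) t)))
  where
  N = 3 + 2 * m
  d = N + 3 + t

theorem3p2p3 : (n : ℕ) → n ≥ 5 → Odd n → (d : ℕ) → d ≥ n + 3 → BHasWinningStrategy n d
theorem3p2p3 _ (s≤s ()) (zero , refl) _ _
theorem3p2p3 _ _ (suc m , refl) d d≥n+3 with m≤n⇒∃[o]m+o≡n d≥n+3
... | t , refl = subst (λ n → BWinsA (n + 3 + t) (board n)) (three+2m≡2[1+m]+1 m) (bWins-board m t)
  where
  three+2m≡2[1+m]+1 : ∀ m → 3 + 2 * m ≡ 2 * suc m + 1
  three+2m≡2[1+m]+1 = solve-∀
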